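{- Let $G$ and $H$ be modules over a principal ideal domain $R$, and let $I$ be a partial isomorphism from $G$ to $H$ (i.e. $I: G \cong_p H$). Then every $f \in I$ is height-preserving: for every prime $p$ of $R$ and every $x \in \operatorname{domain}(f)$, $|f(x)|_p = |x|_p$.
   Context: A partial isomorphism $I: G \cong_p H$ is a nonempty set $I$ of isomorphisms between submodules of $G$ and submodules of $H$ with the back-and-forth property: for any $f \in I$ and $a \in G$ (resp. $b \in H$) there is $g \in I$ with $f \subseteq g$ and $a \in \operatorname{domain}(g)$ (resp. $b \in \operatorname{range}(g)$). For a prime $p$ of $R$ and a module $G$, define $p^\alpha G$ by transfinite induction: $p^0G=G$, $p^{\beta+1}G = p(p^\beta G)$, and $p^\alpha G=\bigcap_{\beta<\alpha}p^\beta G$ for limit $\alpha$. The $p$-height $|x|_p$ of $x\in G$ is the ordinal $\alpha$ with $x \in p^\alpha G\setminus p^{\alpha+1}G$ if it exists, and the symbol $\infty$ otherwise (with $\infty$ greater than all ordinals); heights are computed in the ambient module ($G$ for elements of $G$, $H$ for elements of $H$). -}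

module Defs where

open import Level using (Level; _⊔_; Lift) renaming (suc to lsuc)
open import Algebra.Bundles using (CommutativeRing)
open import Algebra.Module.Bundles using (Module)
open import Data.Product using (Σ; ∃; _×_; _,_)
open import Data.Sum using (_⊎_)
open import Data.Unit using (⊤)
open import Relation.Nullary using (¬_)

module _ {c ℓ} (R : CommutativeRing c ℓ) where
  open CommutativeRing R

  record IsIdeal (J : Carrier → Set (c ⊔ ℓ)) : Set (c ⊔ ℓ) where
    field
      ideal-resp : ∀ {x y} → x ≈ y → J x → J y
      ideal-0    : J 0#
      ideal-+    : ∀ {x y} → J x → J y → J (x + y)
      ideal-*    : ∀ r {x} → J x → J (r * x)

  IsPrincipal : (Carrier → Set (c ⊔ ℓ)) → Set (c ⊔ ℓ)
  IsPrincipal J = ∃ λ a → ∀ x → (J x → ∃ λ r → x ≈ r * a) × ((∃ λ r → x ≈ r * a) → J x)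

  record IsPID : Set (lsuc (c ⊔ ℓ)) where
    field
      nontrivial : ¬ (1# ≈ 0#)
      noZeroDiv  : ∀ a b → a * b ≈ 0# → a ≈ 0# ⊎ b ≈ 0#
      principal  : ∀ J → IsIdeal J → IsPrincipal J

  _∣R_ : Carrier → Carrier → Set (c ⊔ ℓ)
  a ∣R b = ∃ λ r → b ≈ r * a

  IsUnit : Carrier → Set (c ⊔ ℓ)
  IsUnit a = ∃ λ u → a * u ≈ 1#

  record IsPrime (p : Carrier) : Set (c ⊔ ℓ) where
    field
      prime-nonzero : ¬ (p ≈ 0#)
      prime-nonunit : ¬ IsUnit p
      prime-divides : ∀ a b → p ∣R (a * b) → p ∣R a ⊎ p ∣R b

module _ {c ℓ} {R : CommutativeRing c ℓ} {m ℓm} (M : Module R m ℓm) where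
  open Module M

  record IsSubmodule (A : Carrierᴹ → Set (m ⊔ ℓm)) : Set (c ⊔ m ⊔ ℓm) where
    field
      sub-resp : ∀ {x y} → x ≈ᴹ y → A x → A y
      sub-0    : A 0ᴹ
      sub-+    : ∀ {x y} → A x → A y → A (x +ᴹ y)
      sub-*    : ∀ r {x} → A x → A (r *ₗ x)

module _ {c ℓ} {R : CommutativeRing c ℓ} {m₁ ℓ₁ m₂ ℓ₂}
         (G : Module R m₁ ℓ₁) (H : Module R m₂ ℓ₂) where
  private
    module G = Module G
    module H = Module H

  record SubIso : Set (lsuc (c ⊔ m₁ ⊔ ℓ₁ ⊔ m₂ ⊔ ℓ₂)) where
    field
      dom     : G.Carrierᴹ → Set (m₁ ⊔ ℓ₁)
      ran     : H.Carrierᴹ → Set (m₂ ⊔ ℓ₂)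
      dom-sub : IsSubmodule G dom
      ran-sub : IsSubmodule H ran
      fun     : (x : G.Carrierᴹ) → dom x → H.Carrierᴹ
      fun-ran : ∀ x (dx : dom x) → ran (fun x dx)
      fun-cong : ∀ {x y} (dx : dom x) (dy : dom y) → x G.≈ᴹ y → fun x dx H.≈ᴹ fun y dy
      fun-+   : ∀ {x y} (dx : dom x) (dy : dom y) (dxy : dom (x G.+ᴹ y)) →
                fun (x G.+ᴹ y) dxy H.≈ᴹ (fun x dx H.+ᴹ fun y dy)
      fun-*   : ∀ r {x} (dx : dom x) (drx : dom (r G.*ₗ x)) →
                fun (r G.*ₗ x) drx H.≈ᴹ (r H.*ₗ fun x dx)
      fun-inj : ∀ {x y} (dx : dom x) (dy : dom y) → fun x dx H.≈ᴹ fun y dy → x G.≈ᴹ y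
      fun-surj : ∀ y → ran y → Σ G.Carrierᴹ λ x → Σ (dom x) λ dx → fun x dx H.≈ᴹ y

  open SubIso public

  _⊆ᵢ_ : SubIso → SubIso → Set (m₁ ⊔ ℓ₁ ⊔ ℓ₂)
  f ⊆ᵢ g = ∀ x (dx : dom f x) → Σ (dom g x) λ dx' → fun g x dx' H.≈ᴹ fun f x dx

  record PartialIso (i : Level) : Set (lsuc (c ⊔ m₁ ⊔ ℓ₁ ⊔ m₂ ⊔ ℓ₂ ⊔ i)) where
    field
      I        : SubIso → Set i
      nonempty : Σ SubIso I
      forth    : ∀ f → I f → ∀ (a : G.Carrierᴹ) →
                 Σ SubIso λ g → I g × f ⊆ᵢ g × dom g a
      back     : ∀ f → I f → ∀ (b : H.Carrierᴹ) →
                 Σ SubIso λ g → I g × f ⊆ᵢ g × ran g b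

-- Ordinals (Brouwer trees with limits over arbitrary index types in Set o);
-- lim A h denotes the supremum of the ordinals h a.

data Ord (o : Level) : Set (lsuc o) where
  zero : Ord o
  succ : Ord o → Ord o
  lim  : (A : Set o) → (A → Ord o) → Ord o

module _ {c ℓ} {R : CommutativeRing c ℓ} {m ℓm} (M : Module R m ℓm)
         (p : CommutativeRing.Carrier R) where
  open Module M

  _∈p^_ : ∀ {o} → Carrierᴹ → Ord o → Set (m ⊔ ℓm ⊔ o)
  x ∈p^ zero      = Lift _ ⊤
  x ∈p^ succ α    = Σ Carrierᴹ λ y → (y ∈p^ α) × (x ≈ᴹ (p *ₗ y))
  x ∈p^ lim A h   = ∀ (a : A) → x ∈p^ h a

  HasHeight : ∀ {o} → Ord o → Carrierᴹ → Set (m ⊔ ℓm ⊔ o)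
  HasHeight α x = (x ∈p^ α) × ¬ (x ∈p^ succ α)

  HeightInfinite : ∀ o → Carrierᴹ → Set (m ⊔ ℓm ⊔ lsuc o)
  HeightInfinite o x = ∀ (α : Ord o) → x ∈p^ α

module _ {c ℓ} {R : CommutativeRing c ℓ} {m₁ ℓ₁ m₂ ℓ₂}
         (G : Module R m₁ ℓ₁) (H : Module R m₂ ℓ₂)
         (p : CommutativeRing.Carrier R) where

  SameHeight : ∀ o → Module.Carrierᴹ G → Module.Carrierᴹ H →
               Set (m₁ ⊔ ℓ₁ ⊔ m₂ ⊔ ℓ₂ ⊔ lsuc o)
  SameHeight o x y =
    (∀ (α : Ord o) → (HasHeight G p α x → HasHeight H p α y) ×
                     (HasHeight H p α y → HasHeight G p α x)) ×
    ((HeightInfinite G p o x → HeightInfinite H p o y) ×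
     (HeightInfinite H p o y → HeightInfinite G p o x))

module Submission where

-- For every f ∈ I
-- and x ∈ dom f we show, by induction on the ordinal α and simultaneously
-- for all members of I,
--   (forth)  x ∈ p^α G  ⇒  f x ∈ p^α H,
--   (back)   f x ∈ p^α H  ⇒  x ∈ p^α G.  At a successor, x = p·y with y ∈ p^α G: the forth
-- property extends f to some g ∈ I with y ∈ dom g, and then
-- f x = g (p·y) = p·g y with g y ∈ p^α H by induction.  Symmetrically, if
-- f x = p·z with z ∈ p^α H, the back property extends f to g ∈ I with
-- z = g y, and injectivity of g turns g x = p·g y into x = p·y.
-- Both heights being determined by these membership relations, f x and x
-- have the same height, finite or infinite.

open import Defs
open import Level using (Level; _⊔_; lift)
open import Algebra.Bundles using (CommutativeRing)
open import Algebra.Module.Bundles using (Module)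
open import Data.Product using (_,_; proj₁; proj₂)
open import Data.Unit using (tt)
import Relation.Binary.Reasoning.Setoid as SetoidReasoning

∈p^-resp : ∀ {c ℓ m ℓm o} {R : CommutativeRing c ℓ} (M : Module R m ℓm)
           (p : CommutativeRing.Carrier R) (α : Ord o) {x y : Module.Carrierᴹ M} →
           Module._≈ᴹ_ M x y → _∈p^_ M p x α → _∈p^_ M p y α
∈p^-resp M p zero     x≈y x∈ = x∈
∈p^-resp M p (succ α) x≈y (z , z∈ , x≈pz) =
  z , z∈ , Module.≈ᴹ-trans M (Module.≈ᴹ-sym M x≈y) x≈pz
∈p^-resp M p (lim A h) x≈y x∈ a = ∈p^-resp M p (h a) x≈y (x∈ a)

module _ {c ℓ m₁ ℓ₁ m₂ ℓ₂ : Level} {R : CommutativeRing c ℓ}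
         {G : Module R m₁ ℓ₁} {H : Module R m₂ ℓ₂}
         (p : CommutativeRing.Carrier R) where
  private
    module G = Module G
    module H = Module H
    _⊆_ : SubIso G H → SubIso G H → Set (m₁ ⊔ ℓ₁ ⊔ ℓ₂)
    _⊆_ = _⊆ᵢ_ G H
  open SetoidReasoning H.≈ᴹ-setoid

  image-of-multiple : (f g : SubIso G H) → f ⊆ g →
    ∀ {x y} (dx : dom f x) (dy : dom g y) → x G.≈ᴹ p G.*ₗ y →
    fun f x dx H.≈ᴹ p H.*ₗ fun g y dy
  image-of-multiple f g f⊆g {x} {y} dx dy x≈py = begin
    fun f x dx           ≈⟨ H.≈ᴹ-sym (proj₂ (f⊆g x dx)) ⟩
    fun g x dx'          ≈⟨ fun-cong g dx' dpy x≈py ⟩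
    fun g (p G.*ₗ y) dpy ≈⟨ fun-* g p dy dpy ⟩
    p H.*ₗ fun g y dy    ∎
    where
      dx' = proj₁ (f⊆g x dx)
      dpy = IsSubmodule.sub-* (dom-sub g) p dy

  multiple-of-preimage : (f g : SubIso G H) → f ⊆ g →
    ∀ {x y} (dx : dom f x) (dy : dom g y) →
    fun f x dx H.≈ᴹ p H.*ₗ fun g y dy → x G.≈ᴹ p G.*ₗ y
  multiple-of-preimage f g f⊆g {x} {y} dx dy fx≈pgy = fun-inj g dx' dpy (begin
    fun g x dx'          ≈⟨ proj₂ (f⊆g x dx) ⟩
    fun f x dx           ≈⟨ fx≈pgy ⟩
    p H.*ₗ fun g y dy    ≈⟨ H.≈ᴹ-sym (fun-* g p dy dpy) ⟩
    fun g (p G.*ₗ y) dpy ∎)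
    where
      dx' = proj₁ (f⊆g x dx)
      dpy = IsSubmodule.sub-* (dom-sub g) p dy

  module _ {i : Level} (Iso : PartialIso G H i) where
    open PartialIso Iso

    preserves-∈p^ : ∀ {o} (α : Ord o) (f : SubIso G H) → I f →
      ∀ x (dx : dom f x) → _∈p^_ G p x α → _∈p^_ H p (fun f x dx) α
    preserves-∈p^ zero      f If x dx _ = lift tt
    preserves-∈p^ (succ α)  f If x dx (y , y∈ , x≈py)
      with forth f If y
    ... | g , Ig , f⊆g , dy =
      fun g y dy , preserves-∈p^ α g Ig y dy y∈ ,
      image-of-multiple f g f⊆g dx dy x≈py
    preserves-∈p^ (lim A h) f If x dx x∈ a =
      preserves-∈p^ (h a) f If x dx (x∈ a)

    reflects-∈p^ : ∀ {o} (α : Ord o) (f : SubIso G H) → I f →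
      ∀ x (dx : dom f x) → _∈p^_ H p (fun f x dx) α → _∈p^_ G p x α
    reflects-∈p^ zero      f If x dx _ = lift tt
    reflects-∈p^ (succ α)  f If x dx (z , z∈ , fx≈pz)
      with back f If z
    ... | g , Ig , f⊆g , rz
      with fun-surj g z rz
    ... | y , dy , gy≈z =
      y , reflects-∈p^ α g Ig y dy (∈p^-resp H p α (H.≈ᴹ-sym gy≈z) z∈) ,
      multiple-of-preimage f g f⊆g dx dy
        (H.≈ᴹ-trans fx≈pz (H.*ₗ-congˡ (H.≈ᴹ-sym gy≈z)))
    reflects-∈p^ (lim A h) f If x dx fx∈ a =
      reflects-∈p^ (h a) f If x dx (fx∈ a)

lemma1 : ∀ {c ℓ m₁ ℓ₁ m₂ ℓ₂ i : Level} (o : Level)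
    (R : CommutativeRing c ℓ) → IsPID R →
    (G : Module R m₁ ℓ₁) (H : Module R m₂ ℓ₂) (Iso : PartialIso G H i) →
    ∀ (f : SubIso G H) → PartialIso.I Iso f →
    ∀ (p : CommutativeRing.Carrier R) → IsPrime R p →
    ∀ (x : Module.Carrierᴹ G) (dx : dom f x) →
    SameHeight G H p o x (fun f x dx)
lemma1 o R _ G H Iso f If p _ x dx =
  (λ α → ( (λ (x∈ , x∉) → forth α x∈ , λ fx∈ → x∉ (back (succ α) fx∈))
         , (λ (fx∈ , fx∉) → back α fx∈ , λ x∈ → fx∉ (forth (succ α) x∈))))
  , (λ x∞ α → forth α (x∞ α))
  , (λ fx∞ α → back α (fx∞ α))
  where
    forth : ∀ (α : Ord o) → _∈p^_ G p x α → _∈p^_ H p (fun f x dx) α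
    forth α = preserves-∈p^ p Iso α f If x dx

    back : ∀ (α : Ord o) → _∈p^_ H p (fun f x dx) α → _∈p^_ G p x α
    back α = reflects-∈p^ p Iso α f If x dx
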